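{- Let $N_1,\dots,N_d$ be positive integers, $\Omega=[N_1]\times\cdots\times[N_d]$ and $X\subseteq\Omega$. For any integer $1\le s\le\min_{1\le i\le d}N_i$, \[ f(s,X)\le 5^d\frac{N_1\cdots N_d}{s^{d+1}}|X|. \]
   Context: $[n]=\{1,\dots,n\}$. For $\mathbf{b}\in\mathbb{Z}^d\setminus\{\mathbf{0}\}$, $\mathbf{x}\equiv\mathbf{x}'\pmod{\mathbf{b}}$ means $\mathbf{x}-\mathbf{x}'=k\mathbf{b}$ for some integer $k$. The family $\mathcal{C}_X$: for each $\mathbf{b}\in\mathbb{Z}^d\setminus\{\mathbf{0}\}$ and each congruence class $I$ of $X$ modulo $\mathbf{b}$, write $I=\{\mathbf{x}_1,\dots,\mathbf{x}_l\}$ ordered by increasing $\mathbf{x}_u\cdot\mathbf{b}$; $\mathcal{C}_X$ consists of all sets $\{\mathbf{x}_u:(j-1)s+1\le u\le js\}$ with $s$ a power of $2$ and $1\le j\le\lfloor l/s\rfloor$, over all $\mathbf{b}$ and $I$. $f(s,X)$ denotes the number of sets of size $s$ in $\mathcal{C}_X$ (in the paper $f(s,X)$ is considered for $s$ a power of $2$). -}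

module Defs where

open import Data.Nat as ℕ using (ℕ; _^_; _∸_) renaming (_≤_ to _≤ℕ_; _*_ to _*ℕ_)
open import Data.Integer as ℤ using (ℤ; +_; _-_; _*_; _+_; _<_; _≤_)
open import Data.Vec as V using (Vec; []; _∷_; zipWith; replicate)
open import Data.List as L using (List; length; take; drop)
open import Data.List.Membership.Propositional using (_∈_)
open import Data.List.Relation.Unary.All using (All)
open import Data.List.Relation.Unary.AllPairs using (AllPairs)
open import Data.List.Relation.Unary.Linked using (Linked)
open import Data.Product using (Σ; _×_; ∃; ∃-syntax)
open import Function.Bundles using (_⇔_)
open import Relation.Binary.PropositionalEquality using (_≡_)
open import Relation.Nullary using (¬_)

Point : ℕ → Set
Point d = Vec ℤ d

dot : ∀ {d} → Point d → Point d → ℤ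
dot [] [] = + 0
dot (x ∷ xs) (y ∷ ys) = x * y + dot xs ys

_≡_mod_ : ∀ {d} → Point d → Point d → Point d → Set
x ≡ x' mod b = ∃[ k ] (zipWith _-_ x x' ≡ V.map (k *_) b)

InΩ : ∀ {d} → Vec ℕ d → Point d → Set
InΩ [] [] = Data.Unit.⊤ where import Data.Unit
InΩ (n ∷ ns) (x ∷ xs) = (+ 1 ≤ x × x ≤ + n) × InΩ ns xs

prodN : ∀ {d} → Vec ℕ d → ℕ
prodN = V.foldr _ _*ℕ_ 1

IsPow2 : ℕ → Set
IsPow2 t = ∃[ k ] (t ≡ 2 ^ k)

_≋_ : ∀ {d} → List (Point d) → List (Point d) → Set
S ≋ T = ∀ x → (x ∈ S) ⇔ (x ∈ T)

IsOrderedClass : ∀ {d} → List (Point d) → Point d → Point d → List (Point d) → Set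
IsOrderedClass X b x₀ I =
  (∀ x → (x ∈ I) ⇔ ((x ∈ X) × (x ≡ x₀ mod b)))
  × Linked (λ x y → dot x b < dot y b) I

-- S ∈ 𝒞_X and S has size s: S = {x_u : (j-1)s+1 ≤ u ≤ js} for some
-- b ≠ 0, some congruence class I = {x_1,…,x_l} of X mod b (ordered by
-- increasing x_u · b), s a power of 2 and 1 ≤ j ≤ ⌊l/s⌋.
InC : ∀ {d} → List (Point d) → ℕ → List (Point d) → Set
InC {d} X s S =
  Σ (Point d) λ b → ¬ (b ≡ replicate d (+ 0)) ×
  Σ (Point d) λ x₀ → x₀ ∈ X ×
  Σ (List (Point d)) λ I → IsOrderedClass X b x₀ I ×
  IsPow2 s ×
  Σ ℕ λ j → 1 ≤ℕ j × j *ℕ s ≤ℕ length I ×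
  S ≋ take s (drop ((j ∸ 1) *ℕ s) I)

-- f(s,X) * q ≤ k, i.e. f(s,X) ≤ k / q.  f(s,X) is the number of distinct
-- sets of size s in 𝒞_X; "f(s,X)·q ≤ k" is expressed as: every list of
-- pairwise distinct (as sets) members of 𝒞_X of size s has length·q ≤ k.
fTimesAtMost : ∀ {d} → ℕ → List (Point d) → ℕ → ℕ → Set
fTimesAtMost {d} s X q k =
  (F : List (List (Point d))) → All (InC X s) F →
  AllPairs (λ S T → ¬ (S ≋ T)) F → length F *ℕ q ≤ℕ k

-- A member of 𝒞_X of size s ≥ 2 consists of s consecutive points of a congruence class of X
-- mod b, ordered by x · b; its first and last points differ by K b with K ≥ s − 1 and both lie
-- in Ω, so (s − 1)|bᵢ| ≤ Nᵢ − 1 for every i. This leaves at most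
-- ∏ (2⌊(Nᵢ − 1)/(s − 1)⌋ + 1) ≤ 5^d ∏ Nᵢ / s^d directions b. Label each member by the s pairs
-- (b, x) with x in it: a direction and a point determine the class, and the blocks of a class
-- are disjoint, so distinct members get disjoint labels and f(s,X) · s ≤ #directions · |X|.
-- For s = 1 the members are distinct singletons of X.

module Submission where

open import Defs
open import Data.Nat using (ℕ; zero; suc; _∸_; _^_; NonZero)
import Data.Nat as Nat
import Data.Nat.Properties as ℕP
open import Data.Integer using (ℤ; +_; -[1+_]; +≤+)
import Data.Integer as Int
import Data.Integer.Properties as ℤP
open import Algebra.Properties.CommutativeSemigroup ℕP.*-commutativeSemigroup using (xy∙z≈xz∙y)
open import Data.Vec as V using (Vec; []; _∷_; zipWith)
import Data.Vec.Properties as VP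
import Data.Vec.Relation.Unary.All as VAll
open import Data.Vec.Relation.Binary.Pointwise.Inductive using (Pointwise; []; _∷_)
open import Data.List as L using (List; []; _∷_; [_]; _++_; length; take; drop; concatMap; cartesianProductWith; cartesianProduct)
import Data.List.Properties as LP
open import Data.List.Membership.Propositional using (_∈_)
open import Data.List.Membership.Propositional.Properties
  using (∈-∃++; ∈-++⁺ˡ; ∈-++⁺ʳ; ∈-++⁻; ∈-map⁻; ∈-concat⁻′; ∈-cartesianProductWith⁺; ∈-cartesianProduct⁺)
open import Data.List.Relation.Unary.Any using (here; there)
open import Data.List.Relation.Unary.All as All using (All; []; _∷_)
import Data.List.Relation.Unary.All.Properties as AllP
open import Data.List.Relation.Unary.AllPairs as AllPairs using (AllPairs; []; _∷_)
import Data.List.Relation.Unary.AllPairs.Properties as AllPairsP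
open import Data.List.Relation.Unary.Linked using (Linked; []; [-]; _∷_)
open import Data.List.Relation.Unary.Linked.Properties using (Linked⇒AllPairs; AllPairs⇒Linked)
open import Data.List.Relation.Unary.Unique.Propositional using (Unique)
import Data.List.Relation.Unary.Unique.Propositional.Properties as UniqueP
open import Data.List.Relation.Binary.Subset.Propositional using (_⊆_)
open import Data.List.Relation.Binary.Disjoint.Propositional using (Disjoint)
open import Data.Product using (Σ; ∃; _×_; _,_; proj₁; proj₂)
open import Data.Sum using (inj₁; inj₂)
open import Data.Empty using (⊥; ⊥-elim)
open import Function using (_on_)
open import Function.Bundles using (_⇔_; Equivalence; mk⇔)
import Function.Properties.Equivalence as ⇔
open import Relation.Binary.Definitions using (Asymmetric; tri<; tri≈; tri>)
open import Relation.Binary.PropositionalEquality using (_≡_; refl; sym; trans; cong; cong₂; subst; module ≡-Reasoning)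
open import Relation.Nullary using (¬_; yes; no; contradiction)

module _ {A : Set} where
  open Nat using (_+_; _*_; _≤_; z≤n; s≤s)

  unique-⊆⇒length-≤ : {xs ys : List A} → Unique xs → xs ⊆ ys → length xs ≤ length ys
  unique-⊆⇒length-≤ {[]} _ _ = z≤n
  unique-⊆⇒length-≤ {x ∷ xs} (x∉xs ∷ xs!) xs⊆ys with ∈-∃++ (xs⊆ys (here refl))
  ... | us , vs , refl = subst (suc (length xs) ≤_) (sym (LP.length-++-sucʳ us x vs))
                           (s≤s (unique-⊆⇒length-≤ xs! xs⊆us++vs))
    where
    xs⊆us++vs : xs ⊆ us ++ vs
    xs⊆us++vs y∈xs with ∈-++⁻ us (xs⊆ys (there y∈xs))
    ... | inj₁ y∈us         = ∈-++⁺ˡ y∈us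
    ... | inj₂ (here refl)  = ⊥-elim (All.lookup x∉xs y∈xs refl)
    ... | inj₂ (there y∈vs) = ∈-++⁺ʳ us y∈vs

  ∈-take⁻ : ∀ n {x} (xs : List A) → x ∈ take n xs → x ∈ xs
  ∈-take⁻ (suc n) (y ∷ xs) (here x≡y)  = here x≡y
  ∈-take⁻ (suc n) (y ∷ xs) (there x∈) = there (∈-take⁻ n xs x∈)

  ∈-drop⁻ : ∀ n {x} (xs : List A) → x ∈ drop n xs → x ∈ xs
  ∈-drop⁻ zero    xs       x∈ = x∈
  ∈-drop⁻ (suc n) (y ∷ xs) x∈ = there (∈-drop⁻ n xs x∈)

  take-drop-disjoint : ∀ m n {x} (xs : List A) → Unique xs → m ≤ n →
                       x ∈ take m xs → x ∈ drop n xs → ⊥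
  take-drop-disjoint (suc m) (suc n) (y ∷ xs) (y∉xs ∷ _) _ (here refl) x∈ =
    All.lookup y∉xs (∈-drop⁻ n xs x∈) refl
  take-drop-disjoint (suc m) (suc n) (y ∷ xs) (_ ∷ xs!) (s≤s m≤n) (there x∈) x∈′ =
    take-drop-disjoint m n xs xs! m≤n x∈ x∈′

  -- The u-th block of length s (counting from 0); the paper's j-th block is block s (j ∸ 1).
  block : ℕ → ℕ → List A → List A
  block s u xs = take s (drop (u * s) xs)

  length-block : ∀ s u (xs : List A) → suc u * s ≤ length xs → length (block s u xs) ≡ s
  length-block s u xs fits = begin
    length (take s (drop (u * s) xs))  ≡⟨ LP.length-take s (drop (u * s) xs) ⟩
    s Nat.⊓ length (drop (u * s) xs)   ≡⟨ cong (s Nat.⊓_) (LP.length-drop (u * s) xs) ⟩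
    s Nat.⊓ (length xs ∸ u * s)        ≡⟨ ℕP.m≤n⇒m⊓n≡m (ℕP.m+n≤o⇒m≤o∸n s fits) ⟩
    s                                  ∎
    where open ≡-Reasoning

  blocks-disjoint : ∀ s {v v′ x} (xs : List A) → Unique xs → v Nat.< v′ →
                    x ∈ block s v xs → x ∈ block s v′ xs → ⊥
  blocks-disjoint s {v} {v′} xs xs! v<v′ x∈ x∈′ =
    take-drop-disjoint s (v′ * s ∸ v * s) (drop (v * s) xs) (UniqueP.drop⁺ (v * s) xs!) gap x∈
      (subst (_ ∈_) (sym shift) (∈-take⁻ s (drop (v′ * s) xs) x∈′))
    where
    end≤start : v * s + s ≤ v′ * s
    end≤start = subst (_≤ v′ * s) (ℕP.+-comm s (v * s)) (ℕP.*-monoˡ-≤ s v<v′)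
    gap : s ≤ v′ * s ∸ v * s
    gap = ℕP.m+n≤o⇒m≤o∸n s (subst (_≤ v′ * s) (ℕP.+-comm (v * s) s) end≤start)
    shift : drop (v′ * s ∸ v * s) (drop (v * s) xs) ≡ drop (v′ * s) xs
    shift = trans (LP.drop-drop (v * s) (v′ * s ∸ v * s) xs)
              (cong (λ k → drop k xs) (ℕP.m+[n∸m]≡n (ℕP.≤-trans (ℕP.m≤m+n (v * s) s) end≤start)))

  block-index-unique : ∀ s {u u′ x} (xs : List A) → Unique xs →
                       x ∈ block s u xs → x ∈ block s u′ xs → u ≡ u′
  block-index-unique s {u} {u′} xs xs! x∈ x∈′ with ℕP.<-cmp u u′
  ... | tri< u<u′ _ _ = ⊥-elim (blocks-disjoint s xs xs! u<u′ x∈ x∈′)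
  ... | tri≈ _ u≡u′ _ = u≡u′
  ... | tri> _ _ u′<u = ⊥-elim (blocks-disjoint s xs xs! u′<u x∈′ x∈)

  ∈-block⁻ : ∀ s u {x} (xs : List A) → x ∈ block s u xs → x ∈ xs
  ∈-block⁻ s u xs x∈ = ∈-drop⁻ (u * s) xs (∈-take⁻ s (drop (u * s) xs) x∈)

  All-block⁺ : ∀ {P : A → Set} s u {xs : List A} → All P xs → All P (block s u xs)
  All-block⁺ s u all = AllP.take⁺ s (AllP.drop⁺ (u * s) all)

  AllPairs-block⁺ : ∀ {R : A → A → Set} s u {xs : List A} → AllPairs R xs → AllPairs R (block s u xs)
  AllPairs-block⁺ s u all = AllPairsP.take⁺ s (AllPairsP.drop⁺ (u * s) all)

  length≡1⇒≡[_] : ∀ {x} {xs : List A} → length xs ≡ 1 → x ∈ xs → xs ≡ [ x ]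
  length≡1⇒≡[_] {xs = _ ∷ []} refl (here refl) = refl

  sorted-unique : ∀ {R : A → A → Set} → Asymmetric R → {xs ys : List A} →
                  AllPairs R xs → AllPairs R ys → (∀ x → x ∈ xs ⇔ x ∈ ys) → xs ≡ ys
  sorted-unique asym {[]} {[]} _ _ same = refl
  sorted-unique asym {[]} {y ∷ ys} _ _ same with Equivalence.from (same y) (here refl)
  ... | ()
  sorted-unique asym {x ∷ xs} {[]} _ _ same with Equivalence.to (same x) (here refl)
  ... | ()
  sorted-unique {R} asym {x ∷ xs} {y ∷ ys} (x< ∷ xs<) (y< ∷ ys<) same =
    cong₂ _∷_ x≡y (sorted-unique asym xs< ys< (λ z → mk⇔ (to-tail z) (from-tail z)))
    where
    x≡y : x ≡ y
    x≡y with Equivalence.to (same x) (here refl) | Equivalence.from (same y) (here refl)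
    ... | here x≡y  | _          = x≡y
    ... | there x∈ | here y≡x   = sym y≡x
    ... | there x∈ | there y∈   = ⊥-elim (asym (All.lookup y< x∈) (All.lookup x< y∈))
    to-tail : ∀ z → z ∈ xs → z ∈ ys
    to-tail z z∈ with Equivalence.to (same z) (there z∈)
    ... | here refl = ⊥-elim (asym r r) where r = subst (R x) (sym x≡y) (All.lookup x< z∈)
    ... | there z∈′ = z∈′
    from-tail : ∀ z → z ∈ ys → z ∈ xs
    from-tail z z∈ with Equivalence.from (same z) (there z∈)
    ... | here refl = ⊥-elim (asym r r) where r = subst (R y) x≡y (All.lookup y< z∈)
    ... | there z∈′ = z∈′

  Linked-map-All : ∀ {P : A → Set} {R S : A → A → Set} → (∀ {x y} → P x → P y → R x y → S x y) →
                   {xs : List A} → All P xs → Linked R xs → Linked S xs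
  Linked-map-All f _ [] = []
  Linked-map-All f _ [-] = [-]
  Linked-map-All f (px ∷ py ∷ ps) (r ∷ rs) = f px py r ∷ Linked-map-All f (py ∷ ps) rs

map-proj₁-toList : ∀ {B : Set} {P : B → Set} {xs : List B} (ps : All P xs) → L.map proj₁ (All.toList ps) ≡ xs
map-proj₁-toList []       = refl
map-proj₁-toList (p ∷ ps) = cong (_ ∷_) (map-proj₁-toList ps)

module _ {W A : Set} (label : W → List A) {s : ℕ} (length-label : ∀ w → length (label w) ≡ s) where
  open Nat using (_*_; _≤_)

  length-concatMap : (ws : List W) → length (concatMap label ws) ≡ length ws * s
  length-concatMap []       = refl
  length-concatMap (w ∷ ws) = begin
    length (label w ++ concatMap label ws)              ≡⟨ LP.length-++ (label w) ⟩
    length (label w) Nat.+ length (concatMap label ws)  ≡⟨ cong₂ Nat._+_ (length-label w) (length-concatMap ws) ⟩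
    s Nat.+ length ws * s                               ∎
    where open ≡-Reasoning

  packing-bound : (U : List A) (ws : List W) → (∀ w → Unique (label w)) → (∀ w → label w ⊆ U) →
                  AllPairs (Disjoint on label) ws → length ws * s ≤ length U
  packing-bound U ws label! label⊆U disjoint = begin
    length ws * s                ≡⟨ length-concatMap ws ⟨
    length (concatMap label ws)  ≤⟨ unique-⊆⇒length-≤ labels! labels⊆U ⟩
    length U                     ∎
    where
    open ℕP.≤-Reasoning
    labels! : Unique (concatMap label ws)
    labels! = UniqueP.concat⁺ (AllP.map⁺ (All.universal label! ws)) (AllPairsP.map⁺ disjoint)
    labels⊆U : concatMap label ws ⊆ U
    labels⊆U v∈ with ∈-concat⁻′ (L.map label ws) v∈
    ... | vs , v∈vs , vs∈ with ∈-map⁻ label vs∈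
    ... | w , _ , refl = label⊆U w v∈vs

module _ where
  open Int using (_+_; _-_; _*_; -_; _≤_; _<_)
  open import Data.Integer.Tactic.RingSolver using (solve-∀)

  infixl 6 _-ᵥ_
  infixr 7 _*ᵥ_

  _-ᵥ_ : ∀ {d} → Point d → Point d → Point d
  _-ᵥ_ = zipWith _-_

  _*ᵥ_ : ∀ {d} → ℤ → Point d → Point d
  k *ᵥ b = V.map (k *_) b

  -ᵥ-self : ∀ {d} (x b : Point d) → x -ᵥ x ≡ + 0 *ᵥ b
  -ᵥ-self []       []       = refl
  -ᵥ-self (x ∷ xs) (c ∷ bs) = cong₂ _∷_ (trans (ℤP.+-inverseʳ x) (sym (ℤP.*-zeroˡ c))) (-ᵥ-self xs bs)

  -ᵥ-sym : ∀ {d} (x y b : Point d) {k} → x -ᵥ y ≡ k *ᵥ b → y -ᵥ x ≡ (- k) *ᵥ b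
  -ᵥ-sym []       []       []       e = refl
  -ᵥ-sym (x ∷ xs) (y ∷ ys) (c ∷ bs) {k} e = cong₂ _∷_ head-eq (-ᵥ-sym xs ys bs {k} (VP.∷-injectiveʳ e))
    where
    open ≡-Reasoning
    flip-difference : ∀ x y → y - x ≡ - (x - y)
    flip-difference = solve-∀
    head-eq : y - x ≡ (- k) * c
    head-eq = begin
      y - x      ≡⟨ flip-difference x y ⟩
      - (x - y)  ≡⟨ cong -_ (VP.∷-injectiveˡ e) ⟩
      - (k * c)  ≡⟨ ℤP.neg-distribˡ-* k c ⟩
      (- k) * c  ∎

  -ᵥ-trans : ∀ {d} (x y z b : Point d) {k l} → x -ᵥ y ≡ k *ᵥ b → y -ᵥ z ≡ l *ᵥ b → x -ᵥ z ≡ (k + l) *ᵥ b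
  -ᵥ-trans []       []       []       []       e e′ = refl
  -ᵥ-trans (x ∷ xs) (y ∷ ys) (z ∷ zs) (c ∷ bs) {k} {l} e e′ =
    cong₂ _∷_ head-eq (-ᵥ-trans xs ys zs bs {k} {l} (VP.∷-injectiveʳ e) (VP.∷-injectiveʳ e′))
    where
    open ≡-Reasoning
    split : ∀ x y z → x - z ≡ (x - y) + (y - z)
    split = solve-∀
    head-eq : x - z ≡ (k + l) * c
    head-eq = begin
      x - z              ≡⟨ split x y z ⟩
      (x - y) + (y - z)  ≡⟨ cong₂ _+_ (VP.∷-injectiveˡ e) (VP.∷-injectiveˡ e′) ⟩
      k * c + l * c      ≡⟨ ℤP.*-distribʳ-+ c k l ⟨
      (k + l) * c        ∎

  mod-sym : ∀ {d} {x y b : Point d} → x ≡ y mod b → y ≡ x mod b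
  mod-sym {x = x} {y} {b} (k , e) = - k , -ᵥ-sym x y b {k} e

  mod-trans : ∀ {d} {x y z b : Point d} → x ≡ y mod b → y ≡ z mod b → x ≡ z mod b
  mod-trans {x = x} {y} {z} {b} (k , e) (l , e′) = k + l , -ᵥ-trans x y z b {k} {l} e e′

  dot-shift : ∀ {d} (x y b : Point d) {m} → y -ᵥ x ≡ m *ᵥ b → dot y b ≡ dot x b + m * dot b b
  dot-shift []       []       []       {m} e = cong (_+_ (+ 0)) (sym (ℤP.*-zeroʳ m))
  dot-shift (x ∷ xs) (y ∷ ys) (c ∷ bs) {m} e = begin
    y * c + dot ys bs                              ≡⟨ cong₂ (λ u v → u * c + v) y≡ (dot-shift xs ys bs {m} (VP.∷-injectiveʳ e)) ⟩
    (x + m * c) * c + (dot xs bs + m * dot bs bs)  ≡⟨ regroup x c m (dot xs bs) (dot bs bs) ⟩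
    (x * c + dot xs bs) + m * (c * c + dot bs bs)  ∎
    where
    open ≡-Reasoning
    add-difference : ∀ x y → y ≡ x + (y - x)
    add-difference = solve-∀
    regroup : ∀ x c m p q → (x + m * c) * c + (p + m * q) ≡ (x * c + p) + m * (c * c + q)
    regroup = solve-∀
    y≡ : y ≡ x + m * c
    y≡ = trans (add-difference x y) (cong (λ v → x + v) (VP.∷-injectiveˡ e))

  dot-self-nonNeg : ∀ {d} (b : Point d) → + 0 ≤ dot b b
  dot-self-nonNeg []       = +≤+ Nat.z≤n
  dot-self-nonNeg (c ∷ bs) = ℤP.+-mono-≤ (square-nonNeg c) (dot-self-nonNeg bs)
    where
    square-nonNeg : ∀ c → + 0 ≤ c * c
    square-nonNeg (+ zero)  = +≤+ Nat.z≤n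
    square-nonNeg (+ suc n) = +≤+ Nat.z≤n
    square-nonNeg -[1+ n ]  = +≤+ Nat.z≤n

  coefficient-positive : ∀ {d} (x y b : Point d) {m} → y -ᵥ x ≡ m *ᵥ b → dot x b < dot y b → + 1 ≤ m
  coefficient-positive x y b {m} e x<y with + 1 ℤP.≤? m
  ... | yes 1≤m = 1≤m
  ... | no  1≰m = contradiction x<y (ℤP.≤⇒≯ y≤x)
    where
    open ℤP.≤-Reasoning
    D = dot b b
    m≤0 : m ≤ + 0
    m≤0 = ℤP.i<j⇒i≤pred[j] (ℤP.≰⇒> 1≰m)
    y≤x : dot y b ≤ dot x b
    y≤x = begin
      dot y b           ≡⟨ dot-shift x y b {m} e ⟩
      dot x b + m * D   ≤⟨ ℤP.+-monoʳ-≤ (dot x b) (ℤP.*-monoʳ-≤-nonNeg D {{Int.nonNegative (dot-self-nonNeg b)}} m≤0) ⟩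
      dot x b + + 0     ≡⟨ ℤP.+-identityʳ (dot x b) ⟩
      dot x b           ∎

  Ahead : ∀ {d} → Point d → ℕ → Point d → Point d → Set
  Ahead b k x y = Σ ℤ λ m → + k ≤ m × y -ᵥ x ≡ m *ᵥ b

  ahead-refl : ∀ {d} {b x : Point d} → Ahead b 0 x x
  ahead-refl {b = b} {x} = + 0 , ℤP.≤-refl , -ᵥ-self x b

  ahead-trans : ∀ {d} {b x y z : Point d} {k l} → Ahead b k x y → Ahead b l y z → Ahead b (k Nat.+ l) x z
  ahead-trans {b = b} {x} {y} {z} (m , k≤m , e) (m′ , l≤m′ , e′) =
    m + m′ , ℤP.+-mono-≤ k≤m l≤m′ ,
    subst (λ c → z -ᵥ x ≡ c *ᵥ b) (ℤP.+-comm m′ m) (-ᵥ-trans z y x b {m′} {m} e′ e)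

  ahead-of-< : ∀ {d} {b x₀ x y : Point d} → x ≡ x₀ mod b → y ≡ x₀ mod b → dot x b < dot y b → Ahead b 1 x y
  ahead-of-< {b = b} {x = x} {y} x≡x₀ y≡x₀ x<y with mod-trans y≡x₀ (mod-sym x≡x₀)
  ... | m , e = m , coefficient-positive x y b e x<y , e

  Linked-ahead : ∀ {d} {b y : Point d} {ys} → Linked (Ahead b 1) (y ∷ ys) →
                 Σ (Point d) λ z → z ∈ y ∷ ys × Ahead b (length ys) y z
  Linked-ahead [-] = _ , here refl , ahead-refl
  Linked-ahead (a ∷ as) with Linked-ahead as
  ... | z , z∈ , a′ = z , there z∈ , ahead-trans a a′

  FitsIn : ∀ {d} → ℕ → Vec ℕ d → Point d → Set
  FitsIn k = Pointwise (λ n c → k Nat.* Int.∣ c ∣ Nat.≤ n ∸ 1)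

  ∣-∣≤-interval : ∀ {n y z} → (+ 1 ≤ y × y ≤ + n) → (+ 1 ≤ z × z ≤ + n) → Int.∣ z - y ∣ Nat.≤ n ∸ 1
  ∣-∣≤-interval {n} {+ i} {+ j} (+≤+ 1≤i , +≤+ i≤n) (+≤+ 1≤j , +≤+ j≤n)
    rewrite ℤP.[+m]-[+n]≡m⊖n j i with ℕP.≤-total i j
  ... | inj₁ i≤j = ℕP.≤-trans (ℕP.≤-reflexive (trans (ℤP.∣m⊖n∣≡∣n⊖m∣ j i) (ℤP.∣⊖∣-≤ i≤j))) (ℕP.∸-mono j≤n 1≤i)
  ... | inj₂ j≤i = ℕP.≤-trans (ℕP.≤-reflexive (ℤP.∣⊖∣-≤ j≤i)) (ℕP.∸-mono i≤n 1≤j)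

  step-fits : ∀ {k n y z c m} → (+ 1 ≤ y × y ≤ + n) → (+ 1 ≤ z × z ≤ + n) →
              z - y ≡ m * c → + k ≤ m → k Nat.* Int.∣ c ∣ Nat.≤ n ∸ 1
  step-fits {k} {n} {y} {z} {c} {+ m} y∈ z∈ e (+≤+ k≤m) = begin
    k Nat.* Int.∣ c ∣   ≤⟨ ℕP.*-monoˡ-≤ Int.∣ c ∣ k≤m ⟩
    m Nat.* Int.∣ c ∣   ≡⟨ ℤP.abs-* (+ m) c ⟨
    Int.∣ + m * c ∣     ≡⟨ cong Int.∣_∣ e ⟨
    Int.∣ z - y ∣       ≤⟨ ∣-∣≤-interval y∈ z∈ ⟩
    n ∸ 1               ∎
    where open ℕP.≤-Reasoning

  ahead-fits : ∀ {d} {N : Vec ℕ d} {b y z : Point d} {k} → Ahead b k y z → InΩ N y → InΩ N z → FitsIn k N b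
  ahead-fits {N = []} {[]} {[]} {[]} _ _ _ = []
  ahead-fits {N = n ∷ N} {c ∷ b} {y ∷ ys} {z ∷ zs} (m , k≤m , e) (y∈ , ys∈) (z∈ , zs∈) =
    step-fits y∈ z∈ (VP.∷-injectiveˡ e) k≤m ∷ ahead-fits (m , k≤m , VP.∷-injectiveʳ e) ys∈ zs∈

  Linked-fits : ∀ {d} {N : Vec ℕ d} {b y : Point d} {ys} → Linked (Ahead b 1) (y ∷ ys) →
                All (InΩ N) (y ∷ ys) → FitsIn (length ys) N b
  Linked-fits linked inΩ with Linked-ahead linked
  ... | z , z∈ , ahead = ahead-fits ahead (All.lookup inΩ (here refl)) (All.lookup inΩ z∈)

module _ where
  open Nat using (_+_; _*_; _≤_; _/_; z≤n; s≤s)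
  open import Data.Nat.DivMod using (m*n/n≡m; m/n*n≤m; m/n≤m; /-monoˡ-≤)
  open import Data.Nat.Tactic.RingSolver using (solve-∀)

  symRange : ℕ → List ℤ
  symRange zero    = [ + 0 ]
  symRange (suc c) = + suc c ∷ -[1+ c ] ∷ symRange c

  length-symRange : ∀ c → length (symRange c) ≡ suc (2 * c)
  length-symRange zero    = refl
  length-symRange (suc c) = trans (cong (λ l → suc (suc l)) (length-symRange c)) (two-more c)
    where
    two-more : ∀ c → 2 + suc (2 * c) ≡ suc (2 * suc c)
    two-more = solve-∀

  ∈-symRange : ∀ c {z} → Int.∣ z ∣ ≤ c → z ∈ symRange c
  ∈-symRange zero    {+ zero} _ = here refl
  ∈-symRange (suc c) {z} ∣z∣≤ with ℕP.m≤n⇒m<n∨m≡n ∣z∣≤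
  ... | inj₁ (s≤s ∣z∣≤c) = there (there (∈-symRange c ∣z∣≤c))
  ∈-symRange (suc c) {+ .(suc c)}  _ | inj₂ refl = here refl
  ∈-symRange (suc c) { -[1+ .c ]} _ | inj₂ refl = there (here refl)

  length-cartesianProductWith : ∀ {A B C : Set} (f : A → B → C) (xs : List A) (ys : List B) →
                                length (cartesianProductWith f xs ys) ≡ length xs * length ys
  length-cartesianProductWith f []       ys = refl
  length-cartesianProductWith f (x ∷ xs) ys = begin
    length (L.map (f x) ys ++ cartesianProductWith f xs ys)         ≡⟨ LP.length-++ (L.map (f x) ys) ⟩
    length (L.map (f x) ys) + length (cartesianProductWith f xs ys) ≡⟨ cong₂ _+_ (LP.length-map (f x) ys)
                                                                         (length-cartesianProductWith f xs ys) ⟩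
    length ys + length xs * length ys                               ∎
    where open ≡-Reasoning

  candidates : ∀ {d} (k : ℕ) .{{_ : NonZero k}} → Vec ℕ d → List (Point d)
  candidates k []      = [ [] ]
  candidates k (n ∷ N) = cartesianProductWith _∷_ (symRange ((n ∸ 1) / k)) (candidates k N)

  ∈-candidates : ∀ {d} k .{{_ : NonZero k}} {N : Vec ℕ d} {b} → FitsIn k N b → b ∈ candidates k N
  ∈-candidates k []                      = here refl
  ∈-candidates k {n ∷ N} {c ∷ b} (fits ∷ fits′) =
    ∈-cartesianProductWith⁺ _∷_ (∈-symRange _ ∣c∣≤) (∈-candidates k fits′)
    where
    ∣c∣≤ : Int.∣ c ∣ ≤ (n ∸ 1) / k
    ∣c∣≤ = ℕP.≤-trans (ℕP.≤-reflexive (sym (m*n/n≡m Int.∣ c ∣ k)))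
             (/-monoˡ-≤ k (subst (_≤ n ∸ 1) (ℕP.*-comm k Int.∣ c ∣) fits))

  symRange-bound : ∀ t n → 2 + t ≤ n → length (symRange ((n ∸ 1) / suc t)) * (2 + t) ≤ 5 * n
  symRange-bound t (suc r) (s≤s t+1≤r) = begin
    length (symRange c) * (2 + t)        ≡⟨ cong (_* (2 + t)) (length-symRange c) ⟩
    suc (2 * c) * (2 + t)                ≡⟨ expand c t ⟩
    (2 + t) + 2 * (c * suc t) + 2 * c    ≤⟨ ℕP.+-mono-≤ (ℕP.+-mono-≤ (s≤s t+1≤r) (ℕP.*-monoʳ-≤ 2 (m/n*n≤m r (suc t))))
                                                          (ℕP.*-monoʳ-≤ 2 (m/n≤m r (suc t))) ⟩
    suc r + 2 * r + 2 * r                ≡⟨ gather r ⟩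
    1 + 5 * r                            ≤⟨ ℕP.+-monoˡ-≤ (5 * r) {1} {5} (s≤s z≤n) ⟩
    5 + 5 * r                            ≡⟨ ℕP.*-suc 5 r ⟨
    5 * suc r                            ∎
    where
    open ℕP.≤-Reasoning
    c = r / suc t
    expand : ∀ c t → suc (2 * c) * (2 + t) ≡ (2 + t) + 2 * (c * suc t) + 2 * c
    expand = solve-∀
    gather : ∀ r → suc r + 2 * r + 2 * r ≡ 1 + 5 * r
    gather = solve-∀

  candidates-bound : ∀ {d} t (N : Vec ℕ d) → VAll.All (2 + t ≤_) N →
                     length (candidates (suc t) N) * (2 + t) ^ d ≤ 5 ^ d * prodN N
  candidates-bound t []      VAll.[]           = ℕP.≤-refl
  candidates-bound {suc d} t (n ∷ N) (n≥ VAll.∷ N≥) = begin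
    length (cartesianProductWith _∷_ R C) * (s * s ^ d)  ≡⟨ cong (_* (s * s ^ d)) (length-cartesianProductWith _∷_ R C) ⟩
    (length R * length C) * (s * s ^ d)                   ≡⟨ ℕP.[m*n]*[o*p]≡[m*o]*[n*p] (length R) (length C) s (s ^ d) ⟩
    (length R * s) * (length C * s ^ d)                   ≤⟨ ℕP.*-mono-≤ (symRange-bound t n n≥) (candidates-bound t N N≥) ⟩
    (5 * n) * (5 ^ d * prodN N)                           ≡⟨ ℕP.[m*n]*[o*p]≡[m*o]*[n*p] 5 n (5 ^ d) (prodN N) ⟩
    5 * 5 ^ d * (n * prodN N)                             ∎
    where
    open ℕP.≤-Reasoning
    s = 2 + t
    R = symRange ((n ∸ 1) / suc t)
    C = candidates (suc t) N

module _ {d : ℕ} {X : List (Point d)} where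
  open Int using (_<_)

  orderedClass-sorted : ∀ {b x₀ I} → IsOrderedClass X b x₀ I → AllPairs (λ x y → dot x b < dot y b) I
  orderedClass-sorted (_ , linked) = Linked⇒AllPairs ℤP.<-trans linked

  orderedClass-unique : ∀ {b x₀ I} → IsOrderedClass X b x₀ I → Unique I
  orderedClass-unique {b} cls =
    AllPairs.map (λ x<y x≡y → ℤP.<-irrefl (cong (λ v → dot v b) x≡y) x<y) (orderedClass-sorted cls)

  orderedClass-members : ∀ {b x₀ I} → IsOrderedClass X b x₀ I → All (λ x → x ∈ X × x ≡ x₀ mod b) I
  orderedClass-members (members , _) = All.tabulate (λ {x} → Equivalence.to (members x))

  orderedClasses-equal : ∀ {b x₀ x₀′ I I′ x} → IsOrderedClass X b x₀ I → IsOrderedClass X b x₀′ I′ →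
                         x ∈ I → x ∈ I′ → I ≡ I′
  orderedClasses-equal {x = x} cls@(members , _) cls′@(members′ , _) x∈I x∈I′ =
    sorted-unique ℤP.<-asym (orderedClass-sorted cls) (orderedClass-sorted cls′)
      (λ y → mk⇔ (move members members′ x∈I x∈I′) (move members′ members x∈I′ x∈I))
    where
    move : ∀ {b x₀ x₀′ J J′} →
           (∀ y → y ∈ J ⇔ (y ∈ X × y ≡ x₀ mod b)) → (∀ y → y ∈ J′ ⇔ (y ∈ X × y ≡ x₀′ mod b)) →
           x ∈ J → x ∈ J′ → ∀ {y} → y ∈ J → y ∈ J′
    move members members′ x∈J x∈J′ {y} y∈J with Equivalence.to (members y) y∈J
    ... | y∈X , y≡x₀ = Equivalence.from (members′ y) (y∈X , mod-trans y≡x₀ (mod-trans (mod-sym x≡x₀) x≡x₀′))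
      where
      x≡x₀ = proj₂ (Equivalence.to (members x) x∈J)
      x≡x₀′ = proj₂ (Equivalence.to (members′ x) x∈J′)

module _ {d : ℕ} {X : List (Point d)} {s : ℕ} where
  open Nat using (_≤_)

  dir : ∀ {S} → InC X s S → Point d
  dir (b , _) = b

  blockOf : ∀ {S} → InC X s S → List (Point d)
  blockOf (_ , _ , _ , _ , I , _ , _ , j , _) = block s (j ∸ 1) I

  ≋-blockOf : ∀ {S} (p : InC X s S) → S ≋ blockOf p
  ≋-blockOf (_ , _ , _ , _ , _ , _ , _ , _ , _ , _ , S≋) = S≋

  ≋-of-blockOf-≡ : ∀ {S T} (p : InC X s S) (q : InC X s T) → blockOf p ≡ blockOf q → S ≋ T
  ≋-of-blockOf-≡ {T = T} p q same x =
    ⇔.trans (≋-blockOf p x) (subst (λ B → (x ∈ B) ⇔ (x ∈ T)) (sym same) (⇔.sym (≋-blockOf q x)))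

  length-blockOf : ∀ {S} (p : InC X s S) → length (blockOf p) ≡ s
  length-blockOf (_ , _ , _ , _ , I , _ , _ , suc u , _ , fits , _) = length-block s u I fits

  blockOf-unique : ∀ {S} (p : InC X s S) → Unique (blockOf p)
  blockOf-unique (_ , _ , _ , _ , _ , cls , _ , j , _) = AllPairs-block⁺ s (j ∸ 1) (orderedClass-unique cls)

  blockOf-⊆ : ∀ {S} (p : InC X s S) → blockOf p ⊆ X
  blockOf-⊆ (_ , _ , _ , _ , _ , cls , _ , j , _) x∈ =
    proj₁ (All.lookup (All-block⁺ s (j ∸ 1) (orderedClass-members cls)) x∈)

  blockOf-linked : ∀ {S} (p : InC X s S) → Linked (Ahead (dir p) 1) (blockOf p)
  blockOf-linked (_ , _ , _ , _ , _ , cls , _ , j , _) =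
    Linked-map-All (λ (_ , x≡x₀) (_ , y≡x₀) → ahead-of-< x≡x₀ y≡x₀)
      (All-block⁺ s (j ∸ 1) (orderedClass-members cls))
      (AllPairs⇒Linked (AllPairs-block⁺ s (j ∸ 1) (orderedClass-sorted cls)))

  blockOf-fits : ∀ {N S} → 1 ≤ s → All (InΩ N) X → (p : InC X s S) → FitsIn (s ∸ 1) N (dir p)
  blockOf-fits {N} 1≤s X⊆Ω p with blockOf p | length-blockOf p | blockOf-linked p | blockOf-⊆ p
  blockOf-fits () _ _ | [] | refl | _ | _
  ... | y ∷ ys | refl | linked | ⊆X = Linked-fits linked (All.tabulate (λ x∈ → All.lookup X⊆Ω (⊆X x∈)))

  blockOf-overlap : ∀ {S T} (p : InC X s S) (q : InC X s T) → dir p ≡ dir q →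
                    ∀ {x} → x ∈ blockOf p → x ∈ blockOf q → blockOf p ≡ blockOf q
  blockOf-overlap (b , _ , _ , _ , I , cls , _ , j , _) (.b , _ , _ , _ , I′ , cls′ , _ , j′ , _) refl x∈ x∈′
    with orderedClasses-equal cls cls′ (∈-block⁻ s (j ∸ 1) I x∈) (∈-block⁻ s (j′ ∸ 1) I′ x∈′)
  ... | refl = cong (λ u → block s u I) (block-index-unique s {j ∸ 1} {j′ ∸ 1} I (orderedClass-unique cls) x∈ x∈′)

  count-members : ∀ {A : Set} (label : ∃ (InC X s) → List A) (U : List A) →
                  (∀ w → length (label w) ≡ s) → (∀ w → Unique (label w)) → (∀ w → label w ⊆ U) →
                  (∀ w w′ {v} → v ∈ label w → v ∈ label w′ → proj₁ w ≋ proj₁ w′) →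
                  ∀ {F} (ps : All (InC X s) F) → AllPairs (λ S T → ¬ S ≋ T) F → length F Nat.* s ≤ length U
  count-members label U length-label label! label⊆U shared⇒≋ {F} ps F≉ =
    subst (λ l → l Nat.* s ≤ length U) length-ws
      (packing-bound label length-label U ws label! label⊆U (AllPairs.map disjoint ws≉))
    where
    ws = All.toList ps
    length-ws : length ws ≡ length F
    length-ws = trans (sym (LP.length-map proj₁ ws)) (cong length (map-proj₁-toList ps))
    ws≉ : AllPairs ((λ S T → ¬ S ≋ T) on proj₁) ws
    ws≉ = AllPairsP.map⁻ (subst (AllPairs _) (sym (map-proj₁-toList ps)) F≉)
    disjoint : ∀ {w w′} → ¬ proj₁ w ≋ proj₁ w′ → Disjoint (label w) (label w′)
    disjoint {w} {w′} w≉w′ (v∈ , v∈′) = w≉w′ (shared⇒≋ w w′ v∈ v∈′)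

module _ {d : ℕ} {X : List (Point d)} where
  open Nat using (_*_; _≤_; z≤n; s≤s)

  count-singletons : ∀ {F} (ps : All (InC X 1) F) → AllPairs (λ S T → ¬ S ≋ T) F → length F * 1 ≤ length X
  count-singletons = count-members label X (λ (_ , p) → length-blockOf p) (λ (_ , p) → blockOf-unique p)
                       (λ (_ , p) → blockOf-⊆ p) shared⇒≋
    where
    label : ∃ (InC X 1) → List (Point d)
    label (_ , p) = blockOf p
    shared⇒≋ : ∀ w w′ {v} → v ∈ label w → v ∈ label w′ → proj₁ w ≋ proj₁ w′
    shared⇒≋ (_ , p) (_ , q) v∈ v∈′ =
      ≋-of-blockOf-≡ p q (trans (length≡1⇒≡[_] (length-blockOf p) v∈) (sym (length≡1⇒≡[_] (length-blockOf q) v∈′)))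

  count-blocks : ∀ t {N} → All (InΩ N) X → ∀ {F} (ps : All (InC X (2 Nat.+ t)) F) → AllPairs (λ S T → ¬ S ≋ T) F →
                 length F * (2 Nat.+ t) ≤ length (candidates (suc t) N) * length X
  count-blocks t {N} X⊆Ω ps F≉ =
    subst (_ ≤_) (length-cartesianProductWith _,_ (candidates (suc t) N) X)
      (count-members label U length-label label! label⊆U shared⇒≋ ps F≉)
    where
    U = cartesianProduct (candidates (suc t) N) X
    label : ∃ (InC X (2 Nat.+ t)) → List (Point d × Point d)
    label (_ , p) = L.map (dir p ,_) (blockOf p)
    length-label : ∀ w → length (label w) ≡ 2 Nat.+ t
    length-label (_ , p) = trans (LP.length-map (dir p ,_) (blockOf p)) (length-blockOf p)
    label! : ∀ w → Unique (label w)
    label! (_ , p) = UniqueP.map⁺ (cong proj₂) (blockOf-unique p)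
    label⊆U : ∀ w → label w ⊆ U
    label⊆U (_ , p) v∈ with ∈-map⁻ (dir p ,_) v∈
    ... | x , x∈ , refl =
      ∈-cartesianProduct⁺ (∈-candidates (suc t) (blockOf-fits (s≤s z≤n) X⊆Ω p)) (blockOf-⊆ p x∈)
    shared⇒≋ : ∀ w w′ {v} → v ∈ label w → v ∈ label w′ → proj₁ w ≋ proj₁ w′
    shared⇒≋ (_ , p) (_ , q) v∈ v∈′ with ∈-map⁻ (dir p ,_) v∈ | ∈-map⁻ (dir q ,_) v∈′
    ... | x , x∈ , refl | x′ , x′∈ , same =
      ≋-of-blockOf-≡ p q (blockOf-overlap p q (cong proj₁ same) x∈ (subst (_∈ blockOf q) (sym (cong proj₂ same)) x′∈))

prodN-positive : ∀ {d} (N : Vec ℕ d) → VAll.All (1 Nat.≤_) N → 1 Nat.≤ prodN N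
prodN-positive []      VAll.[]           = Nat.s≤s Nat.z≤n
prodN-positive (n ∷ N) (1≤n VAll.∷ 1≤N) = ℕP.*-mono-≤ 1≤n (prodN-positive N 1≤N)

corollary2p4 : (d : ℕ) (N : Vec ℕ d) → VAll.All (1 Nat.≤_) N →
    (X : List (Point d)) → Unique X → All (InΩ N) X →
    (s : ℕ) → 1 Nat.≤ s → VAll.All (s Nat.≤_) N →
    fTimesAtMost s X (s ^ suc d) (5 ^ d Nat.* prodN N Nat.* length X)
corollary2p4 _ _ _   _ _ _ 0 () _
corollary2p4 d N 1≤N X _ _ 1 _ _ F ps F≉ = begin
  length F * 1 ^ suc d           ≡⟨ cong (length F *_) (ℕP.^-zeroˡ (suc d)) ⟩
  length F * 1                   ≤⟨ count-singletons ps F≉ ⟩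
  length X                       ≡⟨ ℕP.*-identityˡ (length X) ⟨
  1 * length X                   ≤⟨ ℕP.*-monoˡ-≤ (length X) (ℕP.*-mono-≤ (ℕP.m^n>0 5 d) (prodN-positive N 1≤N)) ⟩
  5 ^ d * prodN N * length X     ∎
  where open Nat using (_*_); open ℕP.≤-Reasoning
corollary2p4 d N _ X _ X⊆Ω s@(suc (suc t)) _ s≤N F ps F≉ = begin
  length F * (s * s ^ d)                            ≡⟨ ℕP.*-assoc (length F) s (s ^ d) ⟨
  length F * s * s ^ d                              ≤⟨ ℕP.*-monoˡ-≤ (s ^ d) (count-blocks t X⊆Ω ps F≉) ⟩
  length (candidates (suc t) N) * length X * s ^ d  ≡⟨ xy∙z≈xz∙y (length (candidates (suc t) N)) (length X) (s ^ d) ⟩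
  length (candidates (suc t) N) * s ^ d * length X  ≤⟨ ℕP.*-monoˡ-≤ (length X) (candidates-bound t N s≤N) ⟩
  5 ^ d * prodN N * length X                        ∎
  where open Nat using (_*_); open ℕP.≤-Reasoning
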